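{- For integers $\alpha,\beta,\gamma\ge1$ satisfying $\beta\ge1$, $\min(\alpha,\gamma)=1$, $\max(\alpha,\gamma)\ge2$, define linear polynomials $p(n),q(n),r(n)$ as follows. If $\gamma=1$: $p(n)=2^\alpha3^\beta n-1$, $q(n)=n$, $r(n)=2^{\alpha-1}3^\beta n-1$. If $\alpha=1$: let $k$ be the unique integer with $0<k<3^\beta2^\gamma$, $k\equiv-1\pmod{3^\beta}$, $k\equiv1\pmod{2^\gamma}$, and set $p(n)=3^\beta2^\gamma n+k$, $q(n)=2^{\gamma-1}n+\frac{k+1}{2\cdot 3^\beta}$, $r(n)=3^\beta n+\frac{k-1}{2^\gamma}$. Then the Hardy--Littlewood singular series corresponding to the three linear functions $p(n),q(n),r(n)$ is the same for all such choices of $\alpha,\beta,\gamma$.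
   Context: For $R\in\mathbb{N}$ and integers $a_i,b_i$ ($1\le i\le R$) with $\gcd(a_i,b_i)=1$, the Hardy--Littlewood singular series corresponding to the linear functions $a_in+b_i$ is $\mathfrak{S}=\prod_{p\text{ prime}}(1-\rho(p)/p)(1-1/p)^{ -R}$, where $\rho(p)$ is the number of $n\in\mathbb{Z}/p\mathbb{Z}$ with $\prod_{i=1}^R(a_in+b_i)\equiv0\pmod p$. -}

module Defs where

open import Data.Nat as ℕ using (ℕ; zero; suc; _∸_; _≤_; _<_)
open import Data.Nat.Divisibility using (_∣_; _∣?_)
import Data.Nat.Properties as ℕP
import Data.Nat.DivMod as ℕD
open import Data.Nat.Primality using (Prime; prime?)
open import Data.Integer as ℤ using (ℤ; +_; ∣_∣)
open import Data.Rational as ℚ using (ℚ; 1ℚ; _/_)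
open import Data.List using (List; []; _∷_; length; filter; upTo; map; foldr)
open import Data.Product using (_×_; _,_; ∃)
open import Relation.Binary.PropositionalEquality using (_≡_)

LinForm : Set
LinForm = ℤ × ℤ

evalForm : LinForm → ℤ → ℤ
evalForm (a , b) n = a ℤ.* n ℤ.+ b

prodForms : List LinForm → ℤ → ℤ
prodForms fs n = foldr (λ f acc → evalForm f n ℤ.* acc) (+ 1) fs

ρ : List LinForm → ℕ → ℕ
ρ fs p = length (filter (λ n → p ∣? (∣ prodForms fs (+ n) ∣)) (upTo p))

powℚ : ℚ → ℕ → ℚ
powℚ x zero = 1ℚ
powℚ x (suc k) = x ℚ.* powℚ x k

-- local factor (1 - ρ(p)/p) (1 - 1/p)^{-R}, with (1-1/p)^{-1} = p/(p-1);
-- only evaluated at primes p ≥ 2 (values at 0,1 are irrelevant)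
localFactor : List LinForm → ℕ → ℚ
localFactor fs zero = 1ℚ
localFactor fs (suc zero) = 1ℚ
localFactor fs (suc (suc m)) =
  (1ℚ ℚ.- ((+ ρ fs (suc (suc m))) / suc (suc m)))
    ℚ.* powℚ ((+ suc (suc m)) / suc m) (length fs)

partialS : List LinForm → ℕ → ℚ
partialS fs x = foldr (λ p acc → localFactor fs p ℚ.* acc) 1ℚ
                  (filter prime? (upTo (suc x)))

-- the two singular series (limits of the partial products) are equal:
-- the difference of partial products tends to 0
SameSingularSeries : List LinForm → List LinForm → Set
SameSingularSeries fs gs =
  ∀ (ε : ℚ) → ℚ.0ℚ ℚ.< ε →
    ∃ λ (N : ℕ) → ∀ x → N ≤ x → ℚ.∣ partialS fs x ℚ.- partialS gs x ∣ ℚ.< ε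

-- admissible parameters α, β, γ, together with the auxiliary integer k
-- (only constrained, and only used, in the case α = 1)
Valid : ℕ → ℕ → ℕ → ℕ → Set
Valid α β γ k =
  1 ≤ α × 1 ≤ β × 1 ≤ γ × ℕ._⊓_ α γ ≡ 1 × 2 ≤ ℕ._⊔_ α γ ×
  (α ≡ 1 → 0 < k × k < 3 ℕ.^ β ℕ.* 2 ℕ.^ γ
           × ((3 ℕ.^ β) ∣ (k ℕ.+ 1)) × ((2 ℕ.^ γ) ∣ (k ∸ 1)))

div2·3^ : ℕ → ℕ → ℕ
div2·3^ m β = ℕD._/_ m (2 ℕ.* 3 ℕ.^ β) {{ℕP.m*n≢0 2 (3 ℕ.^ β) {{_}} {{ℕP.m^n≢0 3 β}}}}

div2^ : ℕ → ℕ → ℕ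
div2^ m γ = ℕD._/_ m (2 ℕ.^ γ) {{ℕP.m^n≢0 2 γ}}

-- the triple (p, q, r); the case γ = 1 comes first, otherwise α = 1
forms : ℕ → ℕ → ℕ → ℕ → List LinForm
forms α β (suc zero) k =
  (+ (2 ℕ.^ α ℕ.* 3 ℕ.^ β) , ℤ.- (+ 1)) ∷
  (+ 1 , + 0) ∷
  (+ (2 ℕ.^ (α ∸ 1) ℕ.* 3 ℕ.^ β) , ℤ.- (+ 1)) ∷ []
forms α β γ k =
  (+ (3 ℕ.^ β ℕ.* 2 ℕ.^ γ) , + k) ∷
  (+ (2 ℕ.^ (γ ∸ 1)) , + div2·3^ (k ℕ.+ 1) β) ∷
  (+ (3 ℕ.^ β) , + div2^ (k ∸ 1) γ) ∷ []

{-# OPTIONS --safe #-}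
-- Any two of the three forms generate the unit ideal of ℤ[n]. For γ = 1, with B = 2^(α-1) 3^β,
-- p = 2B·q − 1, p − 2r = 1 and B·q − r = 1; for α = 1, with C = 3^β and 2E = 2^γ,
-- p = 2C·q − 1 = 2E·r + 1 and C·q − E·r = 1. So modulo a prime ℓ the forms have no common root
-- and ρ(ℓ) is the sum of their root counts: a form has one root if ℓ does not divide its leading
-- coefficient and none otherwise (the same identities then keep ℓ off its constant term). The leading
-- coefficients are products of powers of 2 and 3, and at ℓ = 2 and at ℓ = 3 exactly one of them is
-- prime to ℓ. Hence every admissible triple has ρ(2) = ρ(3) = 1 and ρ(ℓ) = 3 for ℓ ≥ 5, all local
-- factors agree, and the partial products of the two singular series are equal.
module Submission where

open import Defs
open import Data.Nat as ℕ using (ℕ; zero; suc; _+_; _*_; _^_; _<_; s≤s)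
import Data.Nat.Properties as ℕP
import Data.Nat.DivMod as ℕD
open import Data.Nat.Divisibility as ℕ∣ using (_∣_; _∣?_; divides)
open import Data.Nat.Primality using (Prime; prime?; prime[2]; ¬prime[1]; euclidsLemma; prime⇒irreducible; prime⇒nonZero)
open import Data.Nat.Coprimality as Coprimality using (Coprime; coprime-Bézout; coprime⇒gcd≡1)
open import Data.Nat.LCM using (lcm; lcm-least; gcd*lcm)
open import Data.Nat.GCD using (module Bézout)
open import Data.Integer as ℤ using (ℤ; +_; -[1+_]; 0ℤ; 1ℤ; -1ℤ)
import Data.Integer.Properties as ℤP
import Data.Integer.Divisibility.Signed as ℤ∣
open import Data.Integer.DivMod using (_%ℕ_; _/ℕ_; a≡a%ℕn+[a/ℕn]*n; n%ℕd<d)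
open import Data.Integer.Tactic.RingSolver using (solve-∀)
open import Data.Rational as ℚ using (1ℚ)
import Data.Rational.Properties as ℚP
open import Data.List using (List; []; _∷_; [_]; length; filter; upTo; foldr; map; _++_)
open import Data.Nat.ListAction using (sum)
open import Data.List.Properties using (filter-≐; filter-none; filter-accept; filter-reject; filter-++; length-++; upTo-∷ʳ)
open import Data.List.Relation.Unary.All as All using (All; []; _∷_)
open import Data.List.Relation.Unary.All.Properties using (all-filter; applyUpTo⁺₁)
open import Data.List.Relation.Unary.AllPairs using (AllPairs; []; _∷_)
open import Data.Product using (_×_; _,_; proj₁; proj₂; ∃)
open import Data.Sum using (_⊎_; inj₁; inj₂)
open import Data.Empty using (⊥)
open import Data.Bool using (if_then_else_)
open import Function using (_∘_; id)
open import Level using (Level)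
open import Relation.Nullary using (¬_; Dec; yes; no; does; contradiction)
open import Relation.Nullary.Decidable using (from-no)
open import Relation.Unary using (Pred; Decidable; _∪_; _≐_)
open import Relation.Unary.Properties using (_∪?_)
open import Relation.Binary.PropositionalEquality using (_≡_; refl; sym; trans; cong; cong₂; subst; module ≡-Reasoning)

private
  variable
    ℓ₀ ℓ ℓ′ : Level
    A : Set ℓ₀

module _ {P : Pred A ℓ} {Q : Pred A ℓ′} (P? : Decidable P) (Q? : Decidable Q) where

  length-filter-∪ : (∀ {x} → P x → Q x → ⊥) → ∀ xs →
    length (filter (P? ∪? Q?) xs) ≡ length (filter P? xs) + length (filter Q? xs)
  length-filter-∪ disjoint [] = refl
  length-filter-∪ disjoint (x ∷ xs) with P? x | Q? x
  ... | yes px | yes qx = contradiction qx (disjoint px)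
  ... | yes _  | no _   = cong suc (length-filter-∪ disjoint xs)
  ... | no _   | yes _  = trans (cong suc (length-filter-∪ disjoint xs)) (sym (ℕP.+-suc _ _))
  ... | no _   | no _   = length-filter-∪ disjoint xs

module _ {P : Pred ℕ ℓ} (P? : Decidable P) where

  length-filter-upTo-suc : ∀ m →
    length (filter P? (upTo (suc m))) ≡ length (filter P? (upTo m)) + length (filter P? [ m ])
  length-filter-upTo-suc m = begin
    length (filter P? (upTo (suc m)))               ≡⟨ cong (length ∘ filter P?) (sym (upTo-∷ʳ m)) ⟩
    length (filter P? (upTo m ++ [ m ]))            ≡⟨ cong length (filter-++ P? (upTo m) [ m ]) ⟩
    length (filter P? (upTo m) ++ filter P? [ m ])  ≡⟨ length-++ (filter P? (upTo m)) ⟩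
    length (filter P? (upTo m)) + length (filter P? [ m ]) ∎
    where open ≡-Reasoning

  length-filter-upTo-unique : ∀ {m n₀} → n₀ < m → P n₀ → (∀ {n} → n < m → P n → n ≡ n₀) →
    length (filter P? (upTo m)) ≡ 1
  length-filter-upTo-unique {suc m} {n₀} n₀<1+m Pn₀ unique
    rewrite length-filter-upTo-suc m with n₀ ℕ.≟ m
  ... | yes refl rewrite filter-accept P? {xs = []} Pn₀
                       | filter-none P? (applyUpTo⁺₁ id m λ i<m Pi →
                           ℕP.<-irrefl (unique (ℕP.m<n⇒m<1+n i<m) Pi) i<m) = refl
  ... | no n₀≢m rewrite filter-reject P? {xs = []} (λ Pm → n₀≢m (sym (unique ℕP.≤-refl Pm)))
                      | length-filter-upTo-unique (ℕP.≤∧≢⇒< (ℕP.≤-pred n₀<1+m) n₀≢m) Pn₀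
                                                  (unique ∘ ℕP.m<n⇒m<1+n) = refl

prime∤1 : ∀ {p} → Prime p → ¬ p ∣ 1
prime∤1 pp p∣1 = ¬prime[1] (subst Prime (ℕ∣.∣1⇒≡1 p∣1) pp)

prime∤* : ∀ {p m n} → Prime p → ¬ p ∣ m → ¬ p ∣ n → ¬ p ∣ m * n
prime∤* {m = m} {n} pp p∤m p∤n p∣mn with euclidsLemma m n pp p∣mn
... | inj₁ p∣m = p∤m p∣m
... | inj₂ p∣n = p∤n p∣n

prime∤^ : ∀ {p m} n → Prime p → ¬ p ∣ m → ¬ p ∣ m ^ n
prime∤^ zero    pp _   = prime∤1 pp
prime∤^ (suc n) pp p∤m = prime∤* pp p∤m (prime∤^ n pp p∤m)

prime∤⇒coprime : ∀ {p n} → Prime p → ¬ p ∣ n → Coprime p n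
prime∤⇒coprime pp p∤n (d∣p , d∣n) with prime⇒irreducible pp d∣p
... | inj₁ d≡1 = d≡1
... | inj₂ refl = contradiction d∣n p∤n

∣<⇒≡0 : ∀ {p d} → p ∣ d → d < p → d ≡ 0
∣<⇒≡0 {d = zero}  _   _   = refl
∣<⇒≡0 {d = suc d} p∣d d<p = contradiction p∣d (ℕ∣.>⇒∤ d<p)

infix 4 _∣ℤ_
_∣ℤ_ : ℕ → ℤ → Set
p ∣ℤ x = p ∣ ℤ.∣ x ∣

∣ˡ⇒∣* : ∀ {p} x y → p ∣ℤ x → p ∣ℤ x ℤ.* y
∣ˡ⇒∣* x y p∣x = subst (_ ∣_) (sym (ℤP.abs-* x y)) (ℕ∣.∣m⇒∣m*n ℤ.∣ y ∣ p∣x)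

∣ʳ⇒∣* : ∀ {p} x y → p ∣ℤ y → p ∣ℤ x ℤ.* y
∣ʳ⇒∣* x y p∣y = subst (_ ∣_) (sym (ℤP.abs-* x y)) (ℕ∣.∣n⇒∣m*n ℤ.∣ x ∣ p∣y)

∣-+ : ∀ {p} x y → p ∣ℤ x → p ∣ℤ y → p ∣ℤ x ℤ.+ y
∣-+ {p} x y p∣x p∣y =
  ℤ∣.∣⇒∣ᵤ (ℤ∣.∣m∣n⇒∣m+n (ℤ∣.∣ᵤ⇒∣ {+ p} {x} p∣x) (ℤ∣.∣ᵤ⇒∣ {+ p} {y} p∣y))

∣-neg : ∀ {p} x → p ∣ℤ x → p ∣ℤ ℤ.- x
∣-neg {p} x p∣x = subst (p ∣_) (sym (ℤP.∣-i∣≡∣i∣ x)) p∣x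

∣-linear : ∀ {p} x y u v → p ∣ℤ x → p ∣ℤ y → p ∣ℤ u ℤ.* x ℤ.+ v ℤ.* y
∣-linear x y u v p∣x p∣y = ∣-+ (u ℤ.* x) (v ℤ.* y) (∣ʳ⇒∣* u x p∣x) (∣ʳ⇒∣* v y p∣y)

prime∣*⇒∣⊎∣ : ∀ {p} x y → Prime p → p ∣ℤ x ℤ.* y → p ∣ℤ x ⊎ p ∣ℤ y
prime∣*⇒∣⊎∣ x y pp p∣xy = euclidsLemma ℤ.∣ x ∣ ℤ.∣ y ∣ pp (subst (_ ∣_) (ℤP.abs-* x y) p∣xy)

∃-inverse : ∀ {p} a → Prime p → ¬ p ∣ℤ a → ∃ λ u → p ∣ℤ a ℤ.* u ℤ.- 1ℤ
∃-inverse (+ n)    pp p∤n = ∃-inverse⁺ (coprime-Bézout (Coprimality.sym (prime∤⇒coprime pp p∤n)))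
  where
  ∃-inverse⁺ : ∀ {p n} → Bézout.Identity 1 n p → ∃ λ u → p ∣ℤ + n ℤ.* u ℤ.- 1ℤ
  ∃-inverse⁺ {p} {n} (Bézout.+- x y 1+yp≡xn) = + x , ℤ∣.∣⇒∣ᵤ (ℤ∣.divides (+ y) (begin
    + n ℤ.* + x ℤ.- 1ℤ    ≡⟨ cong (ℤ._- 1ℤ) (sym (ℤP.pos-* n x)) ⟩
    + (n * x) ℤ.- 1ℤ      ≡⟨ cong (λ t → + t ℤ.- 1ℤ) (trans (ℕP.*-comm n x) (sym 1+yp≡xn)) ⟩
    + (1 + y * p) ℤ.- 1ℤ  ≡⟨ ℤP.pos-* y p ⟩
    + y ℤ.* + p           ∎))
    where open ≡-Reasoning
  ∃-inverse⁺ {p} {n} (Bézout.-+ x y 1+xn≡yp) = ℤ.- + x , ℤ∣.∣⇒∣ᵤ (ℤ∣.divides (ℤ.- + y) (begin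
    + n ℤ.* (ℤ.- + x) ℤ.- 1ℤ  ≡⟨ rearrange (+ n) (+ x) ⟩
    ℤ.- (1ℤ ℤ.+ + x ℤ.* + n)  ≡⟨ cong (λ t → ℤ.- (1ℤ ℤ.+ t)) (sym (ℤP.pos-* x n)) ⟩
    ℤ.- + (1 + x * n)         ≡⟨ cong (ℤ.-_ ∘ +_) 1+xn≡yp ⟩
    ℤ.- + (y * p)             ≡⟨ cong ℤ.-_ (ℤP.pos-* y p) ⟩
    ℤ.- (+ y ℤ.* + p)         ≡⟨ ℤP.neg-distribˡ-* (+ y) (+ p) ⟩
    ℤ.- + y ℤ.* + p           ∎))
    where
    open ≡-Reasoning
    rearrange : ∀ n x → n ℤ.* (ℤ.- x) ℤ.- 1ℤ ≡ ℤ.- (1ℤ ℤ.+ x ℤ.* n)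
    rearrange = solve-∀
∃-inverse -[1+ n ] pp p∤n with ∃-inverse (+ suc n) pp p∤n
... | u , p∣nu-1 = ℤ.- u , subst (λ t → _ ∣ℤ t ℤ.- 1ℤ) (negate-both (+ suc n) u) p∣nu-1
  where
  negate-both : ∀ x y → x ℤ.* y ≡ (ℤ.- x) ℤ.* (ℤ.- y)
  negate-both = solve-∀

roots : LinForm → ℕ → ℕ
roots f p = length (filter (λ n → p ∣? ℤ.∣ evalForm f (+ n) ∣) (upTo p))

∃-root : ∀ {p} a b → Prime p → ¬ p ∣ℤ a → ∃ λ n → n < p × p ∣ℤ evalForm (a , b) (+ n)
∃-root {p} a b pp p∤a with ∃-inverse a pp p∤a
... | u , p∣au-1 = n , n%ℕd<d w p , subst (p ∣ℤ_) (sym a*n+b≡combination)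
                                     (∣-linear (a ℤ.* u ℤ.- 1ℤ) (+ p) (ℤ.- b) (ℤ.- (a ℤ.* q)) p∣au-1 ℕ∣.∣-refl)
  where
  instance _ = prime⇒nonZero pp
  w : ℤ
  w = ℤ.- (b ℤ.* u)
  n : ℕ
  n = w %ℕ p
  q : ℤ
  q = w /ℕ p
  open ≡-Reasoning
  a*n+b≡combination : a ℤ.* + n ℤ.+ b ≡ (ℤ.- b) ℤ.* (a ℤ.* u ℤ.- 1ℤ) ℤ.+ (ℤ.- (a ℤ.* q)) ℤ.* + p
  a*n+b≡combination = begin
    a ℤ.* + n ℤ.+ b
      ≡⟨ insert a (+ n) (q ℤ.* + p) b ⟩
    a ℤ.* ((+ n ℤ.+ q ℤ.* + p) ℤ.- q ℤ.* + p) ℤ.+ b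
      ≡⟨ cong (λ t → a ℤ.* (t ℤ.- q ℤ.* + p) ℤ.+ b) (sym (a≡a%ℕn+[a/ℕn]*n w p)) ⟩
    a ℤ.* (w ℤ.- q ℤ.* + p) ℤ.+ b
      ≡⟨ expand a b u q (+ p) ⟩
    (ℤ.- b) ℤ.* (a ℤ.* u ℤ.- 1ℤ) ℤ.+ (ℤ.- (a ℤ.* q)) ℤ.* + p ∎
    where
    insert : ∀ a x y b → a ℤ.* x ℤ.+ b ≡ a ℤ.* ((x ℤ.+ y) ℤ.- y) ℤ.+ b
    insert = solve-∀
    expand : ∀ a b u q P →
      a ℤ.* (ℤ.- (b ℤ.* u) ℤ.- q ℤ.* P) ℤ.+ b ≡ (ℤ.- b) ℤ.* (a ℤ.* u ℤ.- 1ℤ) ℤ.+ (ℤ.- (a ℤ.* q)) ℤ.* P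
    expand = solve-∀

root-unique : ∀ {p} a b → Prime p → ¬ p ∣ℤ a → ∀ {n n′} → n < p → n′ < p →
  p ∣ℤ evalForm (a , b) (+ n) → p ∣ℤ evalForm (a , b) (+ n′) → n ≡ n′
root-unique {p} a b pp p∤a {n} {n′} n<p n′<p p∣fn p∣fn′ =
  ℤP.+-injective (ℤP.i-j≡0⇒i≡j (+ n) (+ n′) (ℤP.∣i∣≡0⇒i≡0 (∣<⇒≡0 p∣n-n′ ∣n-n′∣<p)))
  where
  difference : ∀ a b x y → 1ℤ ℤ.* (a ℤ.* x ℤ.+ b) ℤ.+ -1ℤ ℤ.* (a ℤ.* y ℤ.+ b) ≡ a ℤ.* (x ℤ.- y)
  difference = solve-∀
  p∣a[n-n′] : p ∣ℤ a ℤ.* (+ n ℤ.- + n′)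
  p∣a[n-n′] = subst (p ∣ℤ_) (difference a b (+ n) (+ n′))
    (∣-linear (evalForm (a , b) (+ n)) (evalForm (a , b) (+ n′)) 1ℤ -1ℤ p∣fn p∣fn′)
  p∣n-n′ : p ∣ℤ + n ℤ.- + n′
  p∣n-n′ with prime∣*⇒∣⊎∣ a (+ n ℤ.- + n′) pp p∣a[n-n′]
  ... | inj₁ p∣a    = contradiction p∣a p∤a
  ... | inj₂ p∣n-n′ = p∣n-n′
  ∣n-n′∣<p : ℤ.∣ + n ℤ.- + n′ ∣ < p
  ∣n-n′∣<p = begin-strict
    ℤ.∣ + n ℤ.- + n′ ∣  ≡⟨ cong ℤ.∣_∣ (ℤP.[+m]-[+n]≡m⊖n n n′) ⟩
    ℤ.∣ n ℤ.⊖ n′ ∣      ≤⟨ ℤP.∣m⊝n∣≤m⊔n n n′ ⟩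
    n ℕ.⊔ n′            <⟨ ℕP.⊔-lub n<p n′<p ⟩
    p                   ∎
    where open ℕP.≤-Reasoning

roots≡1 : ∀ {p} a b → Prime p → ¬ p ∣ℤ a → roots (a , b) p ≡ 1
roots≡1 a b pp p∤a with ∃-root a b pp p∤a
... | n₀ , n₀<p , p∣fn₀ =
  length-filter-upTo-unique _ n₀<p p∣fn₀ (λ n<p p∣fn → root-unique a b pp p∤a n<p n₀<p p∣fn p∣fn₀)

roots≡0 : ∀ {p} f → (∀ n → ¬ p ∣ℤ evalForm f (+ n)) → roots f p ≡ 0
roots≡0 {p} f no-root = cong length (filter-none _ (All.universal no-root (upTo p)))

NoCommonRoot : ℕ → LinForm → LinForm → Set
NoCommonRoot p f g = ∀ n → p ∣ℤ evalForm f n → p ∣ℤ evalForm g n → ⊥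

record UnitCombination (u : ℤ) (f : LinForm) (v : ℤ) (g : LinForm) : Set where
  constructor _,_
  field
    leading  : u ℤ.* proj₁ f ℤ.+ v ℤ.* proj₁ g ≡ 0ℤ
    constant : u ℤ.* proj₂ f ℤ.+ v ℤ.* proj₂ g ≡ 1ℤ

unitCombination-eval : ∀ {u v} f g → UnitCombination u f v g →
  ∀ n → u ℤ.* evalForm f n ℤ.+ v ℤ.* evalForm g n ≡ 1ℤ
unitCombination-eval {u} {v} (a , b) (a′ , b′) (ua+va′≡0 , ub+vb′≡1) n = begin
  u ℤ.* (a ℤ.* n ℤ.+ b) ℤ.+ v ℤ.* (a′ ℤ.* n ℤ.+ b′)
    ≡⟨ regroup u v a b a′ b′ n ⟩
  (u ℤ.* a ℤ.+ v ℤ.* a′) ℤ.* n ℤ.+ (u ℤ.* b ℤ.+ v ℤ.* b′)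
    ≡⟨ cong₂ (λ s t → s ℤ.* n ℤ.+ t) ua+va′≡0 ub+vb′≡1 ⟩
  0ℤ ℤ.* n ℤ.+ 1ℤ
    ≡⟨⟩
  1ℤ ∎
  where
  open ≡-Reasoning
  regroup : ∀ u v a b a′ b′ n → u ℤ.* (a ℤ.* n ℤ.+ b) ℤ.+ v ℤ.* (a′ ℤ.* n ℤ.+ b′) ≡
                                (u ℤ.* a ℤ.+ v ℤ.* a′) ℤ.* n ℤ.+ (u ℤ.* b ℤ.+ v ℤ.* b′)
  regroup = solve-∀

module _ {p u v} f g (pp : Prime p) (combination : UnitCombination u f v g) where

  private
    p∤combination : ∀ n → p ∣ℤ u ℤ.* evalForm f n → p ∣ℤ v ℤ.* evalForm g n → ⊥
    p∤combination n p∣uf p∣vg = prime∤1 pp (subst (p ∣ℤ_) (unitCombination-eval {u} {v} f g combination n)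
      (∣-+ (u ℤ.* evalForm f n) (v ℤ.* evalForm g n) p∣uf p∣vg))

  unitCombination⇒noCommonRoot : NoCommonRoot p f g
  unitCombination⇒noCommonRoot n p∣fn p∣gn =
    p∤combination n (∣ʳ⇒∣* u (evalForm f n) p∣fn) (∣ʳ⇒∣* v (evalForm g n) p∣gn)

  unitCombination⇒rootsˡ≡0 : p ∣ℤ v → roots f p ≡ 0
  unitCombination⇒rootsˡ≡0 p∣v = roots≡0 f λ n p∣fn →
    p∤combination (+ n) (∣ʳ⇒∣* u (evalForm f (+ n)) p∣fn) (∣ˡ⇒∣* v (evalForm g (+ n)) p∣v)

  unitCombination⇒rootsʳ≡0 : p ∣ℤ u → roots g p ≡ 0
  unitCombination⇒rootsʳ≡0 p∣u = roots≡0 g λ n p∣gn →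
    p∤combination (+ n) (∣ˡ⇒∣* u (evalForm f (+ n)) p∣u) (∣ʳ⇒∣* v (evalForm g (+ n)) p∣gn)

noCommonRoot-prodForms : ∀ {p} f {gs} → Prime p → All (NoCommonRoot p f) gs →
  ∀ n → p ∣ℤ evalForm f n → ¬ p ∣ℤ prodForms gs n
noCommonRoot-prodForms f pp [] n _ p∣1 = prime∤1 pp p∣1
noCommonRoot-prodForms f {g ∷ gs} pp (f#g ∷ f#gs) n p∣fn p∣gs
  with prime∣*⇒∣⊎∣ (evalForm g n) (prodForms gs n) pp p∣gs
... | inj₁ p∣gn   = f#g n p∣fn p∣gn
... | inj₂ p∣rest = noCommonRoot-prodForms f pp f#gs n p∣fn p∣rest

ρ≡sum-roots : ∀ {p} → Prime p → ∀ fs → AllPairs (NoCommonRoot p) fs → ρ fs p ≡ sum (map (λ f → roots f p) fs)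
ρ≡sum-roots {p} pp [] [] = cong length (filter-none _ (All.universal (λ _ → prime∤1 pp) (upTo p)))
ρ≡sum-roots {p} pp (f ∷ fs) (f#fs ∷ fs-pairwise) = begin
  ρ (f ∷ fs) p
    ≡⟨ cong length (filter-≐ _ (root? f ∪? root-prod?) split (upTo p)) ⟩
  length (filter (root? f ∪? root-prod?) (upTo p))
    ≡⟨ length-filter-∪ (root? f) root-prod? disjoint (upTo p) ⟩
  roots f p + ρ fs p
    ≡⟨ cong (λ t → roots f p + t) (ρ≡sum-roots pp fs fs-pairwise) ⟩
  sum (map (λ f → roots f p) (f ∷ fs)) ∎
  where
  open ≡-Reasoning
  root? : ∀ f n → Dec (p ∣ℤ evalForm f (+ n))
  root? f n = p ∣? ℤ.∣ evalForm f (+ n) ∣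
  root-prod? : ∀ n → Dec (p ∣ℤ prodForms fs (+ n))
  root-prod? n = p ∣? ℤ.∣ prodForms fs (+ n) ∣
  split : (λ n → p ∣ℤ prodForms (f ∷ fs) (+ n)) ≐
          ((λ n → p ∣ℤ evalForm f (+ n)) ∪ (λ n → p ∣ℤ prodForms fs (+ n)))
  split = (λ {n} → prime∣*⇒∣⊎∣ (evalForm f (+ n)) (prodForms fs (+ n)) pp)
        , λ { {n} (inj₁ p∣fn) → ∣ˡ⇒∣* (evalForm f (+ n)) (prodForms fs (+ n)) p∣fn
            ; {n} (inj₂ p∣gs) → ∣ʳ⇒∣* (evalForm f (+ n)) (prodForms fs (+ n)) p∣gs }
  disjoint : ∀ {n} → p ∣ℤ evalForm f (+ n) → p ∣ℤ prodForms fs (+ n) → ⊥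
  disjoint {n} = noCommonRoot-prodForms f pp f#fs (+ n)

ρ-triple : ∀ {p} f g h {i j l} → Prime p → NoCommonRoot p f g → NoCommonRoot p f h → NoCommonRoot p g h →
  roots f p ≡ i → roots g p ≡ j → roots h p ≡ l → ρ (f ∷ g ∷ h ∷ []) p ≡ i + j + l
ρ-triple {p} f g h {i} {j} {l} pp f#g f#h g#h rf rg rh = begin
  ρ (f ∷ g ∷ h ∷ []) p
    ≡⟨ ρ≡sum-roots pp (f ∷ g ∷ h ∷ []) ((f#g ∷ f#h ∷ []) ∷ (g#h ∷ []) ∷ [] ∷ []) ⟩
  roots f p + (roots g p + (roots h p + 0))
    ≡⟨ cong₂ _+_ rf (cong₂ _+_ rg (trans (ℕP.+-identityʳ (roots h p)) rh)) ⟩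
  i + (j + l)
    ≡⟨ sym (ℕP.+-assoc i j l) ⟩
  i + j + l ∎
  where open ≡-Reasoning

localFactor-cong : ∀ {fs gs} p → length fs ≡ length gs → ρ fs p ≡ ρ gs p → localFactor fs p ≡ localFactor gs p
localFactor-cong zero          _ _ = refl
localFactor-cong (suc zero)    _ _ = refl
localFactor-cong (suc (suc m)) |fs|≡|gs| ρfs≡ρgs =
  cong₂ (λ r R → (1ℚ ℚ.- (+ r ℚ./ suc (suc m))) ℚ.* powℚ (+ suc (suc m) ℚ./ suc m) R) ρfs≡ρgs |fs|≡|gs|

partialS-cong : ∀ {fs gs} → (∀ {p} → Prime p → localFactor fs p ≡ localFactor gs p) →
  ∀ x → partialS fs x ≡ partialS gs x
partialS-cong {fs} {gs} localFactor≡ x = product-cong (all-filter prime? (upTo (suc x)))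
  where
  product-cong : ∀ {ps} → All Prime ps →
    foldr (λ p acc → localFactor fs p ℚ.* acc) 1ℚ ps ≡ foldr (λ p acc → localFactor gs p ℚ.* acc) 1ℚ ps
  product-cong []         = refl
  product-cong (pp ∷ pps) = cong₂ ℚ._*_ (localFactor≡ pp) (product-cong pps)

sameSingularSeries : ∀ {fs gs} → length fs ≡ length gs → (∀ {p} → Prime p → ρ fs p ≡ ρ gs p) →
  SameSingularSeries fs gs
sameSingularSeries {fs} {gs} |fs|≡|gs| ρ≡ ε 0<ε = 0 , λ x _ → subst (ℚ._< ε) (sym (∣difference∣≡0 x)) 0<ε
  where
  ∣difference∣≡0 : ∀ x → ℚ.∣ partialS fs x ℚ.- partialS gs x ∣ ≡ ℚ.0ℚ
  ∣difference∣≡0 x = begin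
    ℚ.∣ partialS fs x ℚ.- partialS gs x ∣
      ≡⟨ cong (λ t → ℚ.∣ t ℚ.- partialS gs x ∣) (partialS-cong localFactor≡ x) ⟩
    ℚ.∣ partialS gs x ℚ.- partialS gs x ∣
      ≡⟨ cong ℚ.∣_∣ (ℚP.+-inverseʳ (partialS gs x)) ⟩
    ℚ.0ℚ ∎
    where
    open ≡-Reasoning
    localFactor≡ : ∀ {p} → Prime p → localFactor fs p ≡ localFactor gs p
    localFactor≡ {p} pp = localFactor-cong p |fs|≡|gs| (ρ≡ pp)

-- forms (2 + a) β 1 k reduces to formsγ₁ (2 ^ (1 + a)) (3 ^ β).
module _ (X Y : ℕ) where

  formsγ₁ : List LinForm
  formsγ₁ = (+ (2 * X * Y) , -1ℤ) ∷ (+ 1 , 0ℤ) ∷ (+ (X * Y) , -1ℤ) ∷ []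

  private
    f₁ f₂ f₃ : LinForm
    f₁ = (+ (2 * X * Y) , -1ℤ)
    f₂ = (+ 1 , 0ℤ)
    f₃ = (+ (X * Y) , -1ℤ)

    ∣XY⇒∣2XY : ∀ {p} → p ∣ X * Y → p ∣ 2 * X * Y
    ∣XY⇒∣2XY {p} p∣XY = subst (p ∣_) (sym (ℕP.*-assoc 2 X Y)) (ℕ∣.∣n⇒∣m*n 2 p∣XY)

    [2XY]≡2*[XY] : + (2 * X * Y) ≡ + 2 ℤ.* + (X * Y)
    [2XY]≡2*[XY] = trans (cong +_ (ℕP.*-assoc 2 X Y)) (ℤP.pos-* 2 (X * Y))

    combination₁₂ : UnitCombination -1ℤ f₁ (+ (2 * X * Y)) f₂
    combination₁₂ = identity₀ (+ (2 * X * Y)) , identity₁ (+ (2 * X * Y))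
      where
      identity₀ : ∀ A → -1ℤ ℤ.* A ℤ.+ A ℤ.* 1ℤ ≡ 0ℤ
      identity₀ = solve-∀
      identity₁ : ∀ A → -1ℤ ℤ.* -1ℤ ℤ.+ A ℤ.* 0ℤ ≡ 1ℤ
      identity₁ = solve-∀

    combination₁₃ : UnitCombination 1ℤ f₁ (ℤ.- + 2) f₃
    combination₁₃ =
      trans (cong (λ t → 1ℤ ℤ.* t ℤ.+ ℤ.- + 2 ℤ.* + (X * Y)) [2XY]≡2*[XY]) (identity₀ (+ (X * Y))) , refl
      where
      identity₀ : ∀ B → 1ℤ ℤ.* (+ 2 ℤ.* B) ℤ.+ ℤ.- + 2 ℤ.* B ≡ 0ℤ
      identity₀ = solve-∀

    combination₂₃ : UnitCombination (+ (X * Y)) f₂ -1ℤ f₃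
    combination₂₃ = identity₀ (+ (X * Y)) , identity₁ (+ (X * Y))
      where
      identity₀ : ∀ B → B ℤ.* 1ℤ ℤ.+ -1ℤ ℤ.* B ≡ 0ℤ
      identity₀ = solve-∀
      identity₁ : ∀ B → B ℤ.* 0ℤ ℤ.+ -1ℤ ℤ.* -1ℤ ≡ 1ℤ
      identity₁ = solve-∀

    ρ-formsγ₁ : ∀ {p i j l} → Prime p →
        roots f₁ p ≡ i → roots f₂ p ≡ j → roots f₃ p ≡ l → ρ formsγ₁ p ≡ i + j + l
    ρ-formsγ₁ pp = ρ-triple f₁ f₂ f₃ pp
      (unitCombination⇒noCommonRoot f₁ f₂ pp combination₁₂)
      (unitCombination⇒noCommonRoot f₁ f₃ pp combination₁₃)
      (unitCombination⇒noCommonRoot f₂ f₃ pp combination₂₃)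

  ρ-formsγ₁-∣ : ∀ {p} → Prime p → p ∣ X * Y → ρ formsγ₁ p ≡ 1
  ρ-formsγ₁-∣ pp p∣XY = ρ-formsγ₁ pp
    (unitCombination⇒rootsˡ≡0 f₁ f₂ pp combination₁₂ (∣XY⇒∣2XY p∣XY))
    (roots≡1 (+ 1) 0ℤ pp (prime∤1 pp))
    (unitCombination⇒rootsʳ≡0 f₂ f₃ pp combination₂₃ p∣XY)

  ρ-formsγ₁-∤ : ∀ {p} → Prime p → ¬ p ∣ 2 * X * Y → ρ formsγ₁ p ≡ 3
  ρ-formsγ₁-∤ pp p∤2XY = ρ-formsγ₁ pp
    (roots≡1 (+ (2 * X * Y)) -1ℤ pp p∤2XY)
    (roots≡1 (+ 1) 0ℤ pp (prime∤1 pp))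
    (roots≡1 (+ (X * Y)) -1ℤ pp (p∤2XY ∘ ∣XY⇒∣2XY))

pos-*₃ : ∀ m n o → + (m * (n * o)) ≡ + m ℤ.* (+ n ℤ.* + o)
pos-*₃ m n o = trans (ℤP.pos-* m (n * o)) (cong (+ m ℤ.*_) (ℤP.pos-* n o))

-- forms 1 β (2 + g) k reduces to formsα₁ (3 ^ β) (2 ^ (1 + g)) k m j, with m and j the two quotients in forms.
module _ (C E k m j : ℕ) where

  formsα₁ : List LinForm
  formsα₁ = (+ (C * (2 * E)) , + k) ∷ (+ E , + m) ∷ (+ C , + j) ∷ []

  module _ (m[2C]≡k+1 : m * (2 * C) ≡ k + 1) (1+j[2E]≡k : 1 + j * (2 * E) ≡ k) where

    private
      f₁ f₂ f₃ : LinForm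
      f₁ = (+ (C * (2 * E)) , + k)
      f₂ = (+ E , + m)
      f₃ = (+ C , + j)

      C′ E′ k′ m′ j′ : ℤ
      C′ = + C
      E′ = + E
      k′ = + k
      m′ = + m
      j′ = + j

      b₁₂ : -1ℤ ℤ.* k′ ℤ.+ (+ 2 ℤ.* C′) ℤ.* m′ ≡ 1ℤ
      b₁₂ = begin
        -1ℤ ℤ.* k′ ℤ.+ (+ 2 ℤ.* C′) ℤ.* m′
          ≡⟨ swap k′ C′ m′ ⟩
        -1ℤ ℤ.* k′ ℤ.+ m′ ℤ.* (+ 2 ℤ.* C′)
          ≡⟨ cong (λ t → -1ℤ ℤ.* k′ ℤ.+ t) m′[2C′]≡k′+1 ⟩
        -1ℤ ℤ.* k′ ℤ.+ (k′ ℤ.+ 1ℤ)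
          ≡⟨ cancel k′ ⟩
        1ℤ ∎
        where
        open ≡-Reasoning
        m′[2C′]≡k′+1 : m′ ℤ.* (+ 2 ℤ.* C′) ≡ k′ ℤ.+ 1ℤ
        m′[2C′]≡k′+1 = trans (sym (pos-*₃ m 2 C)) (trans (cong +_ m[2C]≡k+1) (ℤP.pos-+ k 1))
        swap : ∀ k C m → -1ℤ ℤ.* k ℤ.+ (+ 2 ℤ.* C) ℤ.* m ≡ -1ℤ ℤ.* k ℤ.+ m ℤ.* (+ 2 ℤ.* C)
        swap = solve-∀
        cancel : ∀ k → -1ℤ ℤ.* k ℤ.+ (k ℤ.+ 1ℤ) ≡ 1ℤ
        cancel = solve-∀

      b₁₃ : 1ℤ ℤ.* k′ ℤ.+ ℤ.- (+ 2 ℤ.* E′) ℤ.* j′ ≡ 1ℤ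
      b₁₃ = begin
        1ℤ ℤ.* k′ ℤ.+ ℤ.- (+ 2 ℤ.* E′) ℤ.* j′
          ≡⟨ cong (λ t → 1ℤ ℤ.* t ℤ.+ ℤ.- (+ 2 ℤ.* E′) ℤ.* j′) (sym 1+j′[2E′]≡k′) ⟩
        1ℤ ℤ.* (1ℤ ℤ.+ j′ ℤ.* (+ 2 ℤ.* E′)) ℤ.+ ℤ.- (+ 2 ℤ.* E′) ℤ.* j′
          ≡⟨ cancel E′ j′ ⟩
        1ℤ ∎
        where
        open ≡-Reasoning
        1+j′[2E′]≡k′ : 1ℤ ℤ.+ j′ ℤ.* (+ 2 ℤ.* E′) ≡ k′
        1+j′[2E′]≡k′ = trans (cong (λ t → 1ℤ ℤ.+ t) (sym (pos-*₃ j 2 E))) (cong +_ 1+j[2E]≡k)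
        cancel : ∀ E j → 1ℤ ℤ.* (1ℤ ℤ.+ j ℤ.* (+ 2 ℤ.* E)) ℤ.+ ℤ.- (+ 2 ℤ.* E) ℤ.* j ≡ 1ℤ
        cancel = solve-∀

      b₂₃ : C′ ℤ.* m′ ℤ.+ ℤ.- E′ ℤ.* j′ ≡ 1ℤ
      b₂₃ = ℤP.*-cancelˡ-≡ (+ 2) _ _ (begin
        + 2 ℤ.* (C′ ℤ.* m′ ℤ.+ ℤ.- E′ ℤ.* j′)
          ≡⟨ expand C′ E′ k′ m′ j′ ⟩
        (-1ℤ ℤ.* k′ ℤ.+ (+ 2 ℤ.* C′) ℤ.* m′) ℤ.+ (1ℤ ℤ.* k′ ℤ.+ ℤ.- (+ 2 ℤ.* E′) ℤ.* j′)
          ≡⟨ cong₂ ℤ._+_ b₁₂ b₁₃ ⟩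
        + 2 ℤ.* 1ℤ ∎)
        where
        open ≡-Reasoning
        expand : ∀ C E k m j → + 2 ℤ.* (C ℤ.* m ℤ.+ ℤ.- E ℤ.* j) ≡
                 (-1ℤ ℤ.* k ℤ.+ (+ 2 ℤ.* C) ℤ.* m) ℤ.+ (1ℤ ℤ.* k ℤ.+ ℤ.- (+ 2 ℤ.* E) ℤ.* j)
        expand = solve-∀

      combination₁₂ : UnitCombination -1ℤ f₁ (+ 2 ℤ.* C′) f₂
      combination₁₂ =
        trans (cong (λ t → -1ℤ ℤ.* t ℤ.+ (+ 2 ℤ.* C′) ℤ.* E′) (pos-*₃ C 2 E)) (identity C′ E′) , b₁₂
        where
        identity : ∀ C E → -1ℤ ℤ.* (C ℤ.* (+ 2 ℤ.* E)) ℤ.+ (+ 2 ℤ.* C) ℤ.* E ≡ 0ℤ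
        identity = solve-∀

      combination₁₃ : UnitCombination 1ℤ f₁ (ℤ.- (+ 2 ℤ.* E′)) f₃
      combination₁₃ =
        trans (cong (λ t → 1ℤ ℤ.* t ℤ.+ ℤ.- (+ 2 ℤ.* E′) ℤ.* C′) (pos-*₃ C 2 E)) (identity C′ E′) , b₁₃
        where
        identity : ∀ C E → 1ℤ ℤ.* (C ℤ.* (+ 2 ℤ.* E)) ℤ.+ ℤ.- (+ 2 ℤ.* E) ℤ.* C ≡ 0ℤ
        identity = solve-∀

      combination₂₃ : UnitCombination C′ f₂ (ℤ.- E′) f₃
      combination₂₃ = identity C′ E′ , b₂₃
        where
        identity : ∀ C E → C ℤ.* E ℤ.+ ℤ.- E ℤ.* C ≡ 0ℤ
        identity = solve-∀

      ρ-formsα₁ : ∀ {p i j l} → Prime p →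
        roots f₁ p ≡ i → roots f₂ p ≡ j → roots f₃ p ≡ l → ρ formsα₁ p ≡ i + j + l
      ρ-formsα₁ pp = ρ-triple f₁ f₂ f₃ pp
        (unitCombination⇒noCommonRoot f₁ f₂ pp combination₁₂)
        (unitCombination⇒noCommonRoot f₁ f₃ pp combination₁₃)
        (unitCombination⇒noCommonRoot f₂ f₃ pp combination₂₃)

      ∣C⇒∤E : ∀ {p} → Prime p → p ∣ C → ¬ p ∣ E
      ∣C⇒∤E {p} pp p∣C p∣E = prime∤1 pp (subst (p ∣ℤ_) b₂₃
        (∣-+ (C′ ℤ.* m′) (ℤ.- E′ ℤ.* j′) (∣ˡ⇒∣* C′ m′ p∣C) (∣ˡ⇒∣* (ℤ.- E′) j′ (∣-neg E′ p∣E))))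

    ρ-formsα₁-∣C : ∀ {p} → Prime p → p ∣ C → ρ formsα₁ p ≡ 1
    ρ-formsα₁-∣C pp p∣C = ρ-formsα₁ pp
      (unitCombination⇒rootsˡ≡0 f₁ f₂ pp combination₁₂ (∣ʳ⇒∣* (+ 2) C′ p∣C))
      (roots≡1 E′ m′ pp (∣C⇒∤E pp p∣C))
      (unitCombination⇒rootsʳ≡0 f₂ f₃ pp combination₂₃ p∣C)

    ρ-formsα₁-∣E : ∀ {p} → Prime p → p ∣ E → ρ formsα₁ p ≡ 1
    ρ-formsα₁-∣E pp p∣E = ρ-formsα₁ pp
      (unitCombination⇒rootsˡ≡0 f₁ f₃ pp combination₁₃ (∣-neg (+ 2 ℤ.* E′) (∣ʳ⇒∣* (+ 2) E′ p∣E)))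
      (unitCombination⇒rootsˡ≡0 f₂ f₃ pp combination₂₃ (∣-neg E′ p∣E))
      (roots≡1 C′ j′ pp (λ p∣C → ∣C⇒∤E pp p∣C p∣E))

    ρ-formsα₁-∤ : ∀ {p} → Prime p → ¬ p ∣ C * (2 * E) → ρ formsα₁ p ≡ 3
    ρ-formsα₁-∤ pp p∤C[2E] = ρ-formsα₁ pp
      (roots≡1 (+ (C * (2 * E))) k′ pp p∤C[2E])
      (roots≡1 E′ m′ pp (p∤C[2E] ∘ ℕ∣.∣n⇒∣m*n C ∘ ℕ∣.∣n⇒∣m*n 2))
      (roots≡1 C′ j′ pp (p∤C[2E] ∘ ℕ∣.∣m⇒∣m*n (2 * E)))

coprime⇒*∣ : ∀ {m n o} → Coprime m n → m ∣ o → n ∣ o → m * n ∣ o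
coprime⇒*∣ {m} {n} coprime m∣o n∣o = subst (_∣ _) lcm≡m*n (lcm-least m∣o n∣o)
  where
  lcm≡m*n : lcm m n ≡ m * n
  lcm≡m*n = trans (sym (ℕP.*-identityˡ (lcm m n)))
                  (trans (cong (_* lcm m n) (sym (coprime⇒gcd≡1 coprime))) (gcd*lcm m n))

prime∣6⇒∣2^⊎∣3^ : ∀ {p} → Prime p → p ∣ 6 → ∀ i j → p ∣ 2 ^ suc i ⊎ p ∣ 3 ^ suc j
prime∣6⇒∣2^⊎∣3^ pp p∣6 i j with euclidsLemma 2 3 pp p∣6
... | inj₁ p∣2 = inj₁ (ℕ∣.∣-trans p∣2 (ℕ∣.m∣m*n (2 ^ i)))
... | inj₂ p∣3 = inj₂ (ℕ∣.∣-trans p∣3 (ℕ∣.m∣m*n (3 ^ j)))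

prime∤6⇒∤2^×∤3^ : ∀ {p} → Prime p → ¬ p ∣ 6 → ∀ i j → ¬ p ∣ 2 ^ i × ¬ p ∣ 3 ^ j
prime∤6⇒∤2^×∤3^ pp p∤6 i j =
  prime∤^ i pp (λ p∣2 → p∤6 (ℕ∣.∣-trans p∣2 (divides 3 refl))) ,
  prime∤^ j pp (λ p∣3 → p∤6 (ℕ∣.∣-trans p∣3 (divides 2 refl)))

ρ₆ : ℕ → ℕ
ρ₆ p = if does (p ∣? 6) then 1 else 3

ρ≡ρ₆ : ∀ fs {p} → (p ∣ 6 → ρ fs p ≡ 1) → (¬ p ∣ 6 → ρ fs p ≡ 3) → ρ fs p ≡ ρ₆ p
ρ≡ρ₆ fs {p} ∣6⇒ρ≡1 ∤6⇒ρ≡3 with p ∣? 6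
... | yes p∣6 = ∣6⇒ρ≡1 p∣6
... | no  p∤6 = ∤6⇒ρ≡3 p∤6

StandardTriple : List LinForm → Set
StandardTriple fs = length fs ≡ 3 × (∀ {p} → Prime p → ρ fs p ≡ ρ₆ p)

standard-γ₁ : ∀ a b k → StandardTriple (forms (2 + a) (suc b) 1 k)
standard-γ₁ a b k = refl , λ pp → ρ≡ρ₆ (formsγ₁ X Y) (∣6⇒ρ≡1 pp) (∤6⇒ρ≡3 pp)
  where
  X Y : ℕ
  X = 2 ^ suc a
  Y = 3 ^ suc b
  ∣6⇒ρ≡1 : ∀ {p} → Prime p → p ∣ 6 → ρ (formsγ₁ X Y) p ≡ 1
  ∣6⇒ρ≡1 pp p∣6 with prime∣6⇒∣2^⊎∣3^ pp p∣6 a b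
  ... | inj₁ p∣X = ρ-formsγ₁-∣ X Y pp (ℕ∣.∣m⇒∣m*n Y p∣X)
  ... | inj₂ p∣Y = ρ-formsγ₁-∣ X Y pp (ℕ∣.∣n⇒∣m*n X p∣Y)
  ∤6⇒ρ≡3 : ∀ {p} → Prime p → ¬ p ∣ 6 → ρ (formsγ₁ X Y) p ≡ 3
  ∤6⇒ρ≡3 pp p∤6 with prime∤6⇒∤2^×∤3^ pp p∤6 (2 + a) (suc b)
  ... | p∤2X , p∤Y = ρ-formsγ₁-∤ X Y pp (prime∤* pp p∤2X p∤Y)

standard-α₁ : ∀ b g k → 3 ^ suc b ∣ suc k + 1 → 2 ^ (2 + g) ∣ k →
  StandardTriple (forms 1 (suc b) (2 + g) (suc k))
standard-α₁ b g k C∣k+2 2E∣k = refl , λ pp → ρ≡ρ₆ (formsα₁ C E (suc k) m j) (∣6⇒ρ≡1 pp) (∤6⇒ρ≡3 pp)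
  where
  C E m j : ℕ
  C = 3 ^ suc b
  E = 2 ^ suc g
  m = div2·3^ (suc k + 1) (suc b)
  j = div2^ k (2 + g)
  2∣k+2 : 2 ∣ suc k + 1
  2∣k+2 = subst (2 ∣_) (ℕP.+-suc k 1) (ℕ∣.∣m∣n⇒∣m+n (ℕ∣.∣-trans (ℕ∣.m∣m*n E) 2E∣k) ℕ∣.∣-refl)
  2C∣k+2 : 2 * C ∣ suc k + 1
  2C∣k+2 = coprime⇒*∣ (prime∤⇒coprime prime[2] (prime∤^ (suc b) prime[2] (from-no (2 ∣? 3))))
                      2∣k+2 C∣k+2
  m[2C]≡k+2 : m * (2 * C) ≡ suc k + 1
  m[2C]≡k+2 = ℕD.m/n*n≡m {{ℕP.m*n≢0 2 C {{_}} {{ℕP.m^n≢0 3 (suc b)}}}} 2C∣k+2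
  1+j[2E]≡k+1 : 1 + j * (2 * E) ≡ suc k
  1+j[2E]≡k+1 = cong suc (ℕD.m/n*n≡m {{ℕP.m^n≢0 2 (2 + g)}} 2E∣k)
  ∣6⇒ρ≡1 : ∀ {p} → Prime p → p ∣ 6 → ρ (formsα₁ C E (suc k) m j) p ≡ 1
  ∣6⇒ρ≡1 pp p∣6 with prime∣6⇒∣2^⊎∣3^ pp p∣6 g b
  ... | inj₁ p∣E = ρ-formsα₁-∣E C E (suc k) m j m[2C]≡k+2 1+j[2E]≡k+1 pp p∣E
  ... | inj₂ p∣C = ρ-formsα₁-∣C C E (suc k) m j m[2C]≡k+2 1+j[2E]≡k+1 pp p∣C
  ∤6⇒ρ≡3 : ∀ {p} → Prime p → ¬ p ∣ 6 → ρ (formsα₁ C E (suc k) m j) p ≡ 3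
  ∤6⇒ρ≡3 pp p∤6 with prime∤6⇒∤2^×∤3^ pp p∤6 (2 + g) (suc b)
  ... | p∤2E , p∤C = ρ-formsα₁-∤ C E (suc k) m j m[2C]≡k+2 1+j[2E]≡k+1 pp (prime∤* pp p∤C p∤2E)

standard-forms : ∀ α β γ k → Valid α β γ k → StandardTriple (forms α β γ k)
standard-forms zero          _       _             _ (() , _)
standard-forms (suc _)       zero    _             _ (_ , () , _)
standard-forms (suc _)       (suc _) zero          _ (_ , _ , () , _)
standard-forms (suc zero)    (suc _) (suc zero)    _ (_ , _ , _ , _ , s≤s () , _)
standard-forms (suc (suc a)) (suc b) (suc zero)    k _ = standard-γ₁ a b k
standard-forms (suc (suc _)) (suc _) (suc (suc _)) _ (_ , _ , _ , () , _)
standard-forms (suc zero)    (suc b) (suc (suc g)) k (_ , _ , _ , _ , _ , α≡1⇒) with α≡1⇒ refl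
... | s≤s _ , _ , C∣k+1 , 2E∣k-1 = standard-α₁ b g _ C∣k+1 2E∣k-1

lemma4p4 : (α β γ k α′ β′ γ′ k′ : ℕ) → Valid α β γ k → Valid α′ β′ γ′ k′ →
    SameSingularSeries (forms α β γ k) (forms α′ β′ γ′ k′)
lemma4p4 α β γ k α′ β′ γ′ k′ v v′
  with standard-forms α β γ k v | standard-forms α′ β′ γ′ k′ v′
... | |fs|≡3 , ρfs≡ρ₆ | |gs|≡3 , ρgs≡ρ₆ =
  sameSingularSeries (trans |fs|≡3 (sym |gs|≡3)) (λ pp → trans (ρfs≡ρ₆ pp) (sym (ρgs≡ρ₆ pp)))
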